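{- Let $x$ be a variable and let $t\in\mathrm{CL}(\mathcal{B})$ be $T$-normal. Then: (1) if $[x]_T t=\mathsf{K}s$ then $s=t$ and $x\notin\mathrm{FV}(t)$; (2) if $[x]_T t=\mathsf{I}$ then $t=x$; (3) if $[x]_T t=\mathsf{B}t_1t_2$ then $t=t_1t_2'$ for some $t_2'$ with $x\notin\mathrm{FV}(t_1)$ and $t_2=[x]_T t_2'$; (4) if $[x]_T t=\mathsf{B}'t_1t_2t_3$ then $t=t_1t_2t_3'$ for some $t_3'$ with $x\notin\mathrm{FV}(t_1t_2)$ and $t_3=[x]_T t_3'$.
   Context: Lambda-terms are considered up to $\alpha$-equivalence; $\mathrm{FV}(t)$ is the set of free variables of $t$. Fix the combinators $\mathsf{S}=\lambda xyz.xz(yz)$, $\mathsf{K}=\lambda xy.x$, $\mathsf{I}=\lambda x.x$, $\mathsf{B}=\lambda xyz.x(yz)$, $\mathsf{C}=\lambda xyz.xzy$, $\mathsf{S}'=\lambda kxyz.k(xz)(yz)$, $\mathsf{B}'=\lambda kxyz.kx(yz)$, $\mathsf{C}'=\lambda kxyz.k(xz)y$. Let $\mathcal{B}=\{\mathsf{S},\mathsf{K},\mathsf{I},\mathsf{B},\mathsf{C},\mathsf{S}',\mathsf{B}',\mathsf{C}'\}$ and let $\mathrm{CL}(\mathcal{B})$ be the set of terms built from variables and elements of $\mathcal{B}$ using only application (left-associative); equality of such terms is syntactic, combinators treated as atoms. A term is $T$-normal if it contains no subterm of the form $\mathsf{K}t_1t_2$, $\mathsf{I}t$, $\mathsf{B}t_1t_2t_3$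 or $\mathsf{B}'t_1t_2t_3t_4$. Algorithm $T$: for a variable $x$ and $t\in\mathrm{CL}(\mathcal{B})$, $[x]_T t$ is given by the first applicable equation: (1) $[x]_T t=\mathsf{K}t$ if $x\notin\mathrm{FV}(t)$; (2) $[x]_T x=\mathsf{I}$; (3) $[x]_T (s x)=s$ if $x\notin\mathrm{FV}(s)$; (4) $[x]_T (u x t)=\mathsf{C}ut$ if $x\notin\mathrm{FV}(ut)$; (5) $[x]_T (u x t)=\mathsf{S}u([x]_T t)$ if $x\notin\mathrm{FV}(u)$; (6) $[x]_T (u s t)=\mathsf{B}'us([x]_T t)$ if $x\notin\mathrm{FV}(us)$; (7) $[x]_T (u s t)=\mathsf{C}'u([x]_T s)t$ if $x\notin\mathrm{FV}(ut)$; (8) $[x]_T (u s t)=\mathsf{S}'u([x]_T s)([x]_T t)$ if $x\notin\mathrm{FV}(u)$; (9) $[x]_T (s t)=\mathsf{B}s([x]_T t)$ if $x\notin\mathrm{FV}(s)$; (10) $[x]_T (s t)=\mathsf{C}([x]_T s)t$ if $x\notin\mathrm{FV}(t)$; (11) $[x]_T (s t)=\mathsf{S}([x]_T s)([x]_T t)$. -}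

module Defs where

open import Data.Nat using (ℕ)
open import Data.Nat.Properties using (_≟_)
open import Data.Bool using (Bool; true; false; if_then_else_; _∨_; not)
open import Data.Unit using (⊤)
open import Data.Product using (_×_)
open import Relation.Nullary using (¬_; does)

Var : Set
Var = ℕ

data Comb : Set where
  S K I B C S′ B′ C′ : Comb

infixl 9 _·_
data Tm : Set where
  var : Var → Tm
  com : Comb → Tm
  _·_ : Tm → Tm → Tm

data _∈FV_ (x : Var) : Tm → Set where
  here : x ∈FV var x
  left : ∀ {s t} → x ∈FV s → x ∈FV (s · t)
  right : ∀ {s t} → x ∈FV t → x ∈FV (s · t)

_∉FV_ : Var → Tm → Set
x ∉FV t = ¬ (x ∈FV t)

occ : Var → Tm → Bool
occ x (var y) = does (x ≟ y)
occ x (com c) = false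
occ x (s · t) = occ x s ∨ occ x t

data Redex : Tm → Set where
  rK  : ∀ {a b} → Redex (com K · a · b)
  rI  : ∀ {a} → Redex (com I · a)
  rB  : ∀ {a b c} → Redex (com B · a · b · c)
  rB′ : ∀ {a b c d} → Redex (com B′ · a · b · c · d)

TNormal : Tm → Set
TNormal (var x) = ⊤
TNormal (com c) = ⊤
TNormal (s · t) = TNormal s × TNormal t × ¬ Redex (s · t)

isVar : Var → Tm → Bool
isVar x (var y) = does (x ≟ y)
isVar x (com c) = false
isVar x (s · t) = false

_∧′_ : Bool → Bool → Bool
true ∧′ b = b
false ∧′ b = false

-- Equations (9)–(11), given the already-computed abstractions of s and t.
rule9to11 : Var → Tm → Tm → Tm → Tm → Tm
rule9to11 x s t xs xt =
  if not (occ x s) then com B · s · xt                 -- (9)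
  else if not (occ x t) then com C · xs · t            -- (10)
  else com S · xs · xt                                 -- (11)

-- Algorithm T, equations (1)–(11), first applicable equation wins.
-- All recursive calls are on immediate subterms (structural recursion).
abstrT : Var → Tm → Tm
abstrT x (var y) = if does (x ≟ y) then com I else com K · var y      -- (1),(2)
abstrT x (com c) = com K · com c                                        -- (1)
abstrT x (var y · t) =
  if not (occ x (var y · t)) then com K · (var y · t)                   -- (1)
  else if not (occ x (var y)) ∧′ isVar x t then var y                   -- (3)
  else rule9to11 x (var y) t (abstrT x (var y)) (abstrT x t)            -- (9)–(11)
abstrT x (com c · t) =
  if not (occ x (com c · t)) then com K · (com c · t)                   -- (1)
  else if isVar x t then com c                                          -- (3)
  else rule9to11 x (com c) t (abstrT x (com c)) (abstrT x t)            -- (9)–(11)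
abstrT x (u · s · t) =
  if not (occ x (u · s · t)) then com K · (u · s · t)                                 -- (1)
  else if not (occ x (u · s)) ∧′ isVar x t then u · s                                 -- (3)
  else if isVar x s ∧′ not (occ x u ∨ occ x t) then com C · u · t                     -- (4)
  else if isVar x s ∧′ not (occ x u) then com S · u · abstrT x t                      -- (5)
  else if not (occ x u ∨ occ x s) then com B′ · u · s · abstrT x t                    -- (6)
  else if not (occ x u ∨ occ x t) then com C′ · u · abstrT x s · t                    -- (7)
  else if not (occ x u) then com S′ · u · abstrT x s · abstrT x t                     -- (8)
  else rule9to11 x (u · s) t (abstrT x (u · s)) (abstrT x t)                          -- (9)–(11)

[_]T_ : Var → Tm → Tm
[ x ]T t = abstrT x t

-- Results of the shapes K s, I, B t₁ t₂ and B′ t₁ t₂ t₃ arise only from equations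
-- (1), (2), (9) and (6), which expose t directly, or from (3), which returns the
-- function part s of t = s x.  In the latter case s cannot have any of these
-- shapes, since t would then be a K-, I-, B- or B′-redex, contradicting T-normality.
module Submission where

open import Defs
open import Data.Bool using (true; false; T)
open import Data.Bool.Properties using (∨-conicalˡ; ∨-conicalʳ)
open import Data.Empty using (⊥-elim)
open import Data.Nat.Properties using (≡ᵇ⇒≡; ≡⇒≡ᵇ)
open import Data.Product using (_×_; ∃-syntax; _,_)
open import Data.Unit using (tt)
open import Relation.Binary.PropositionalEquality using (_≡_; refl; sym; subst)

∉FV-· : ∀ {x s t} → x ∉FV s → x ∉FV t → x ∉FV (s · t)
∉FV-· x∉s x∉t (left p)  = x∉s p
∉FV-· x∉s x∉t (right p) = x∉t p

occ≡false⇒∉FV : ∀ {x} t → occ x t ≡ false → x ∉FV t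
occ≡false⇒∉FV {x} (var x) e here = subst T e (≡⇒≡ᵇ x x refl)
occ≡false⇒∉FV (s · t) e (left p)  = occ≡false⇒∉FV s (∨-conicalˡ _ _ e) p
occ≡false⇒∉FV (s · t) e (right p) = occ≡false⇒∉FV t (∨-conicalʳ _ _ e) p

isVar≡true⇒≡var : ∀ {x} t → isVar x t ≡ true → t ≡ var x
isVar≡true⇒≡var {x} (var y) e rewrite ≡ᵇ⇒≡ x y (subst T (sym e) tt) = refl

-- r = [ x ]T t by equation (1), (2), (3), (6) or (9) respectively; results of the
-- remaining equations are recorded only by their head C, S, C′ or S′.
data AbstrT (x : Var) : Tm → Tm → Set where
  const    : ∀ {t} → x ∉FV t → AbstrT x t (com K · t)
  ident    : AbstrT x (var x) (com I)
  eta      : ∀ s → AbstrT x (s · var x) s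
  compose′ : ∀ {u s t} → x ∉FV (u · s) → AbstrT x (u · s · t) (com B′ · u · s · [ x ]T t)
  compose  : ∀ {s t} → x ∉FV s → AbstrT x (s · t) (com B · s · [ x ]T t)
  headC    : ∀ {t a b} → AbstrT x t (com C · a · b)
  headS    : ∀ {t a b} → AbstrT x t (com S · a · b)
  headC′   : ∀ {t a b c} → AbstrT x t (com C′ · a · b · c)
  headS′   : ∀ {t a b c} → AbstrT x t (com S′ · a · b · c)

abstrT-AbstrT : ∀ x t → AbstrT x t ([ x ]T t)
abstrT-AbstrT x (var y) with occ x (var y) in e
... | true  rewrite isVar≡true⇒≡var (var y) e = ident
... | false = const (occ≡false⇒∉FV (var y) e)
abstrT-AbstrT x (com c) = const λ ()
abstrT-AbstrT x (var y · t) with occ x (var y) in ey | occ x t in et | isVar x t in vt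
... | false | false | _     = const (∉FV-· (occ≡false⇒∉FV (var y) ey) (occ≡false⇒∉FV t et))
... | false | true  | true  rewrite isVar≡true⇒≡var t vt = eta (var y)
... | false | true  | false = compose (occ≡false⇒∉FV (var y) ey)
... | true  | false | _     = headC
... | true  | true  | _     = headS
abstrT-AbstrT x (com c · t) with occ x t in et | isVar x t in vt
... | false | _     = const (∉FV-· (λ ()) (occ≡false⇒∉FV t et))
... | true  | true  rewrite isVar≡true⇒≡var t vt = eta (com c)
... | true  | false = compose λ ()
abstrT-AbstrT x (u · s · t)
  with occ x u in eu | occ x s in es | occ x t in et | isVar x s | isVar x t in vt
... | false | false | false | _     | _     =
  const (∉FV-· (∉FV-· (occ≡false⇒∉FV u eu) (occ≡false⇒∉FV s es)) (occ≡false⇒∉FV t et))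
... | false | false | true  | _     | true  rewrite isVar≡true⇒≡var t vt = eta (u · s)
... | false | false | true  | true  | false = headS
... | false | false | true  | false | false = compose′ (∉FV-· (occ≡false⇒∉FV u eu) (occ≡false⇒∉FV s es))
... | false | true  | false | true  | _     = headC
... | false | true  | false | false | _     = headC′
... | false | true  | true  | true  | _     = headS
... | false | true  | true  | false | _     = headS′
... | true  | _     | false | true  | _     = headC
... | true  | _     | false | false | _     = headC
... | true  | _     | true  | true  | _     = headS
... | true  | _     | true  | false | _     = headS

Invertible : Var → Tm → Tm → Set
Invertible x t r =
    (∀ s → r ≡ com K · s → s ≡ t × x ∉FV t)
    × (r ≡ com I → t ≡ var x)
    × (∀ t₁ t₂ → r ≡ com B · t₁ · t₂ →
         ∃[ t₂′ ] (t ≡ t₁ · t₂′ × x ∉FV t₁ × t₂ ≡ [ x ]T t₂′))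
    × (∀ t₁ t₂ t₃ → r ≡ com B′ · t₁ · t₂ · t₃ →
         ∃[ t₃′ ] (t ≡ t₁ · t₂ · t₃′ × x ∉FV (t₁ · t₂) × t₃ ≡ [ x ]T t₃′))

AbstrT⇒Invertible : ∀ {x t r} → TNormal t → AbstrT x t r → Invertible x t r
AbstrT⇒Invertible _ (const x∉t) =
  (λ { _ refl → refl , x∉t }) , (λ ()) , (λ _ _ ()) , (λ _ _ _ ())
AbstrT⇒Invertible _ ident = (λ _ ()) , (λ _ → refl) , (λ _ _ ()) , (λ _ _ _ ())
AbstrT⇒Invertible (_ , _ , ¬redex) (eta _) =
  (λ { _ refl → ⊥-elim (¬redex rK) }) , (λ { refl → ⊥-elim (¬redex rI) }) ,
  (λ { _ _ refl → ⊥-elim (¬redex rB) }) , (λ { _ _ _ refl → ⊥-elim (¬redex rB′) })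
AbstrT⇒Invertible _ (compose′ {t = t} x∉us) =
  (λ _ ()) , (λ ()) , (λ _ _ ()) , (λ { _ _ _ refl → t , refl , x∉us , refl })
AbstrT⇒Invertible _ (compose {t = t} x∉s) =
  (λ _ ()) , (λ ()) , (λ { _ _ refl → t , refl , x∉s , refl }) , (λ _ _ _ ())
AbstrT⇒Invertible _ headC  = (λ _ ()) , (λ ()) , (λ _ _ ()) , (λ _ _ _ ())
AbstrT⇒Invertible _ headS  = (λ _ ()) , (λ ()) , (λ _ _ ()) , (λ _ _ _ ())
AbstrT⇒Invertible _ headC′ = (λ _ ()) , (λ ()) , (λ _ _ ()) , (λ _ _ _ ())
AbstrT⇒Invertible _ headS′ = (λ _ ()) , (λ ()) , (λ _ _ ()) , (λ _ _ _ ())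

mainTheorem9 : (x : Var) (t : Tm) → TNormal t →
    (∀ s → [ x ]T t ≡ com K · s → s ≡ t × x ∉FV t)
    × ([ x ]T t ≡ com I → t ≡ var x)
    × (∀ t₁ t₂ → [ x ]T t ≡ com B · t₁ · t₂ →
         ∃[ t₂′ ] (t ≡ t₁ · t₂′ × x ∉FV t₁ × t₂ ≡ [ x ]T t₂′))
    × (∀ t₁ t₂ t₃ → [ x ]T t ≡ com B′ · t₁ · t₂ · t₃ →
         ∃[ t₃′ ] (t ≡ t₁ · t₂ · t₃′ × x ∉FV (t₁ · t₂) × t₃ ≡ [ x ]T t₃′))
mainTheorem9 x t normal = AbstrT⇒Invertible normal (abstrT-AbstrT x t)
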